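{- There are infinitely many connected digraphs which have no kernel but have a good quasi-kernel.
   Context: A kernel of a digraph $D$ is an independent set $K\subseteq V(D)$ such that every vertex of $V(D)\setminus K$ has an arc to some vertex of $K$. A quasi-kernel is an independent set $Q\subseteq V(D)$ such that for every vertex $v\in V(D)\setminus Q$ there is a directed path with one or two arcs from $v$ to some vertex of $Q$. A quasi-kernel $Q$ is good if for each $u\in Q$ there is an arc from $u$ to a vertex which is an in-neighbour of some vertex of $Q$. A digraph is connected if its underlying undirected graph is connected. -}

module Defs where

open import Data.Nat using (ℕ; _≥_)
open import Data.Fin using (Fin)
open import Data.Fin.Subset using (Subset; _∈_; _∉_)
open import Data.Bool using (Bool; T)
open import Data.Product using (Σ; ∃; ∃-syntax; _×_)
open import Data.Sum using (_⊎_)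
open import Relation.Nullary using (¬_)

-- A finite (loopless) digraph on vertex set Fin n, arcs given by a Boolean
-- adjacency relation; multiple arcs are irrelevant for kernels.
record Digraph (n : ℕ) : Set where
  field
    adj      : Fin n → Fin n → Bool
    loopless : ∀ v → ¬ T (adj v v)

open Digraph public

Arc : ∀ {n} → Digraph n → Fin n → Fin n → Set
Arc D u v = T (adj D u v)

Independent : ∀ {n} → Digraph n → Subset n → Set
Independent D S = ∀ u v → u ∈ S → v ∈ S → ¬ Arc D u v

IsKernel : ∀ {n} → Digraph n → Subset n → Set
IsKernel D K = Independent D K ×
  (∀ v → v ∉ K → ∃[ k ] (k ∈ K × Arc D v k))

IsQuasiKernel : ∀ {n} → Digraph n → Subset n → Set
IsQuasiKernel D Q = Independent D Q ×
  (∀ v → v ∉ Q → ∃[ q ] (q ∈ Q × (Arc D v q ⊎ ∃[ w ] (Arc D v w × Arc D w q))))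

IsGoodQuasiKernel : ∀ {n} → Digraph n → Subset n → Set
IsGoodQuasiKernel D Q = IsQuasiKernel D Q ×
  (∀ u → u ∈ Q → ∃[ w ] (Arc D u w × ∃[ q ] (q ∈ Q × Arc D w q)))

HasKernel : ∀ {n} → Digraph n → Set
HasKernel D = ∃[ K ] IsKernel D K

HasGoodQuasiKernel : ∀ {n} → Digraph n → Set
HasGoodQuasiKernel D = ∃[ Q ] IsGoodQuasiKernel D Q

data UWalk {n} (D : Digraph n) : Fin n → Fin n → Set where
  here : ∀ {u} → UWalk D u u
  step : ∀ {u v w} → (Arc D u v ⊎ Arc D v u) → UWalk D v w → UWalk D u w

Connected : ∀ {n} → Digraph n → Set
Connected {n} D = ∀ (u v : Fin n) → UWalk D u v

{-# OPTIONS --safe #-}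
module Submission where

-- The digraph has vertices 0, 1, 2, 3 with arcs 0→1, 1→2, 1→3, 2→0, 2→1, 3→0,
-- plus m pendant vertices each with a single arc into 1.  It has no kernel K:
-- if 1 ∈ K then 0, 3 ∉ K, yet 0 is the only out-neighbour of 3; if 1 ∉ K then
-- 0 ∈ K (1 is its only out-neighbour), so 2, 3 ∉ K, and 1 has no out-neighbour
-- in K.  On the other hand {1} is a good quasi-kernel: every vertex reaches 1
-- in at most two steps (3 via 0), and 1 → 2 → 1 makes it good.

open import Defs
open import Data.Nat using (ℕ; _≥_; _+_)
open import Data.Nat.Properties using (m≤n+m)
open import Data.Fin using (Fin; zero; suc)
open import Data.Fin.Subset using (Subset; _∈_; _∉_; ⁅_⁆)
open import Data.Fin.Subset.Properties using (_∈?_; x∈⁅x⁆; x∈⁅y⁆⇒x≡y)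
open import Data.Bool using (Bool; true; false; T)
open import Data.Unit using (tt)
open import Data.Sum using (_⊎_; inj₁; inj₂; swap)
open import Data.Product using (Σ; ∃; ∃-syntax; _×_; _,_)
open import Relation.Nullary using (¬_; yes; no; contradiction)
open import Relation.Binary.PropositionalEquality using (_≡_; _≢_; refl; subst)

module _ {n} {D : Digraph n} where

  _++ʷ_ : ∀ {u v w} → UWalk D u v → UWalk D v w → UWalk D u w
  here     ++ʷ q = q
  step a p ++ʷ q = step a (p ++ʷ q)

  reverseʷ : ∀ {u v} → UWalk D u v → UWalk D v u
  reverseʷ here       = here
  reverseʷ (step a p) = reverseʷ p ++ʷ step (swap a) here

  connected-via-hub : (h : Fin n) → (∀ v → UWalk D v h) → Connected D
  connected-via-hub h toHub u v = toHub u ++ʷ reverseʷ (toHub v)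

module IndependentSet {n} {D : Digraph n} {S : Subset n} (independent : Independent D S) where

  tail∉ : ∀ {u v} → Arc D u v → v ∈ S → u ∉ S
  tail∉ a v∈S u∈S = independent _ _ u∈S v∈S a

  head∉ : ∀ {u v} → Arc D u v → u ∈ S → v ∉ S
  head∉ a u∈S v∈S = independent _ _ u∈S v∈S a

∈-if-sole-successor∉ : ∀ {n} {D : Digraph n} {K : Subset n} → IsKernel D K →
                       ∀ {u v} → (∀ w → Arc D v w → w ≡ u) → u ∉ K → v ∈ K
∈-if-sole-successor∉ {K = K} (_ , absorbing) {u} {v} sole u∉K with v ∈? K
... | yes v∈K = v∈K
... | no  v∉K with absorbing v v∉K
...   | w , w∈K , a = contradiction (subst (_∈ K) (sole w a) w∈K) u∉K

⁅⁆-isGoodQuasiKernel : ∀ {n} {D : Digraph n} {h w : Fin n} →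
  (∀ v → v ≢ h → Arc D v h ⊎ ∃[ x ] (Arc D v x × Arc D x h)) →
  Arc D h w → Arc D w h → IsGoodQuasiKernel D ⁅ h ⁆
⁅⁆-isGoodQuasiKernel {D = D} {h} {w} reachesHub h→w w→h =
  (independent , quasiAbsorbing) , good
  where
  independent : Independent D ⁅ h ⁆
  independent u v u∈ v∈ a
    with refl ← x∈⁅y⁆⇒x≡y h u∈ | refl ← x∈⁅y⁆⇒x≡y h v∈ = loopless D h a

  quasiAbsorbing : ∀ v → v ∉ ⁅ h ⁆ →
    ∃[ q ] (q ∈ ⁅ h ⁆ × (Arc D v q ⊎ ∃[ x ] (Arc D v x × Arc D x q)))
  quasiAbsorbing v v∉ = h , x∈⁅x⁆ h , reachesHub v (λ { refl → v∉ (x∈⁅x⁆ h) })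

  good : ∀ u → u ∈ ⁅ h ⁆ → ∃[ x ] (Arc D u x × ∃[ q ] (q ∈ ⁅ h ⁆ × Arc D x q))
  good u u∈ with refl ← x∈⁅y⁆⇒x≡y h u∈ = w , h→w , h , x∈⁅x⁆ h , w→h

module _ {m : ℕ} where

  pattern v₀ = zero
  pattern v₁ = suc zero
  pattern v₂ = suc (suc zero)
  pattern v₃ = suc (suc (suc zero))
  pattern pendant i = suc (suc (suc (suc i)))

  arc? : Fin (4 + m) → Fin (4 + m) → Bool
  arc? v₀          v₁ = true
  arc? v₁          v₂ = true
  arc? v₁          v₃ = true
  arc? v₂          v₀ = true
  arc? v₂          v₁ = true
  arc? v₃          v₀ = true
  arc? (pendant _) v₁ = true
  arc? _           _  = false

  arc?-irreflexive : ∀ v → ¬ T (arc? v v)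
  arc?-irreflexive v₀          ()
  arc?-irreflexive v₁          ()
  arc?-irreflexive v₂          ()
  arc?-irreflexive v₃          ()
  arc?-irreflexive (pendant _) ()

hubDigraph : (m : ℕ) → Digraph (4 + m)
hubDigraph m = record { adj = arc? {m} ; loopless = arc?-irreflexive {m} }

module _ (m : ℕ) where

  private
    D : Digraph (4 + m)
    D = hubDigraph m

  successor-of-v₀ : ∀ w → Arc D v₀ w → w ≡ v₁
  successor-of-v₀ v₁ _ = refl

  successor-of-v₃ : ∀ w → Arc D v₃ w → w ≡ v₀
  successor-of-v₃ v₀ _ = refl

  successor-of-v₁ : ∀ w → Arc D v₁ w → w ≡ v₂ ⊎ w ≡ v₃
  successor-of-v₁ v₂ _ = inj₁ refl
  successor-of-v₁ v₃ _ = inj₂ refl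

  hubDigraph-hasNoKernel : ¬ HasKernel D
  hubDigraph-hasNoKernel (K , isKernel@(independent , absorbing)) with v₁ ∈? K
  ... | yes v₁∈K = head∉ {v₁} {v₃} tt v₁∈K v₃∈K
    where
    open IndependentSet {D = D} independent
    v₃∈K : v₃ ∈ K
    v₃∈K = ∈-if-sole-successor∉ {D = D} isKernel successor-of-v₃
             (tail∉ {v₀} {v₁} tt v₁∈K)
  ... | no v₁∉K with absorbing v₁ v₁∉K
  ...   | w , w∈K , v₁→w = tail∉ {w} {v₀} (w→v₀ (successor-of-v₁ w v₁→w)) v₀∈K w∈K
    where
    open IndependentSet {D = D} independent
    v₀∈K : v₀ ∈ K
    v₀∈K = ∈-if-sole-successor∉ {D = D} isKernel successor-of-v₀ v₁∉K
    w→v₀ : w ≡ v₂ ⊎ w ≡ v₃ → Arc D w v₀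
    w→v₀ (inj₁ refl) = tt
    w→v₀ (inj₂ refl) = tt

  walk-to-v₁ : ∀ v → UWalk D v v₁
  walk-to-v₁ v₀          = step (inj₁ tt) here
  walk-to-v₁ v₁          = here
  walk-to-v₁ v₂          = step (inj₁ tt) here
  walk-to-v₁ v₃          = step {v = v₀} (inj₁ tt) (walk-to-v₁ v₀)
  walk-to-v₁ (pendant _) = step (inj₁ tt) here

  reaches-v₁ : ∀ v → v ≢ v₁ → Arc D v v₁ ⊎ ∃[ x ] (Arc D v x × Arc D x v₁)
  reaches-v₁ v₀          _   = inj₁ tt
  reaches-v₁ v₁          v≢v = contradiction refl v≢v
  reaches-v₁ v₂          _   = inj₁ tt
  reaches-v₁ v₃          _   = inj₂ (v₀ , tt , tt)
  reaches-v₁ (pendant _) _   = inj₁ tt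

proposition1 : ∀ (m : ℕ) → ∃[ n ] (n ≥ m × Σ (Digraph n) (λ D →
    Connected D × ¬ HasKernel D × HasGoodQuasiKernel D))
proposition1 m =
  4 + m , m≤n+m m 4 , hubDigraph m ,
  connected-via-hub v₁ (walk-to-v₁ m) ,
  hubDigraph-hasNoKernel m ,
  (⁅ v₁ ⁆ , ⁅⁆-isGoodQuasiKernel {D = hubDigraph m} {w = v₂} (reaches-v₁ m) tt tt)
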